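{- Let $T$ be a tournament on $n\ge 5$ vertices. Then there is a vertex $v$ such that $|E[N^-(v),N^+(v)]|\ge n^2/25$ and $\min\{d^+(v),d^-(v)\}\ge n/25$.
   Context: $N^+(v)$, $N^-(v)$ denote the out- and in-neighbourhoods of $v$ in $T$, and $d^+(v)=|N^+(v)|$, $d^-(v)=|N^-(v)|$. For disjoint vertex sets $X,Y$, $E[X,Y]$ denotes the set of arcs of $T$ directed from a vertex of $X$ to a vertex of $Y$. -}

module Defs where

open import Data.Nat using (ℕ; _+_)
open import Data.Bool using (Bool; true; false; not; _∧_; if_then_else_)
open import Data.Fin using (Fin)
open import Data.List using (List; map)
open import Data.Nat.ListAction using (sum)
open import Data.List using () renaming (allFin to allFinL)
open import Relation.Binary.PropositionalEquality using (_≡_; _≢_)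

record Tournament (n : ℕ) : Set where
  field
    arc      : Fin n → Fin n → Bool
    loopless : ∀ v → arc v v ≡ false
    oneArc   : ∀ u v → u ≢ v → arc u v ≡ not (arc v u)
open Tournament public

count : {n : ℕ} → (Fin n → Bool) → ℕ
count {n} p = sum (map (λ x → if p x then 1 else 0) (allFinL n))

outdeg : {n : ℕ} → Tournament n → Fin n → ℕ
outdeg T v = count (λ y → arc T v y)

indeg : {n : ℕ} → Tournament n → Fin n → ℕ
indeg T v = count (λ x → arc T x v)

-- |E[N⁻(v), N⁺(v)]| : number of arcs x → y with x ∈ N⁻(v), y ∈ N⁺(v)
-- (N⁻(v), N⁺(v) are disjoint in a tournament)
crossArcs : {n : ℕ} → Tournament n → Fin n → ℕ
crossArcs {n} T v =
  sum (map (λ x → count (λ y → arc T x v ∧ arc T v y ∧ arc T x y)) (allFinL n))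

{-# OPTIONS --safe #-}
-- Summing |E[N⁻(v), N⁺(v)]| over all v counts every transitive triple
-- x → v → y, x → y once, by its middle vertex.  Counted by the source x
-- instead, the number is ∑ₓ d⁺(x)(d⁺(x) − 1)/2, which by Cauchy–Schwarz and
-- ∑ₓ d⁺(x) = n(n − 1)/2 is at least n(n − 1)(n − 3)/8 ≥ n³/25 for n ≥ 5.
-- Hence some v has |E[N⁻(v), N⁺(v)]| ≥ n²/25, and as this is at most
-- d⁻(v) d⁺(v) ≤ n · min {d⁺(v), d⁻(v)}, both degrees are at least n/25.
module Submission where

open import Defs
open import Data.Bool using (Bool; true; false; _∧_; if_then_else_)
open import Data.Fin using (Fin; zero; suc; _≟_)
open import Data.Fin.Properties using (punchInᵢ≢i)
open import Data.List using (map; tabulate) renaming (allFin to allFinᴸ)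
open import Data.List.Properties using (map-tabulate)
open import Data.Nat using (ℕ; zero; suc; _+_; _*_; _≤_; z≤n; s≤s; _≤?_)
open import Data.Nat.ListAction using () renaming (sum to sumᴸ)
open import Data.Nat.Properties hiding (_≟_)
open import Algebra.Properties.Semiring.Sum +-*-semiring
  using (sum; sum-syntax; sum-cong-≗; sum-replicate-zero; sum-remove;
         ∑-distrib-+; ∑-comm; *-distribˡ-sum; *-distribʳ-sum)
open import Data.Nat.Tactic.RingSolver using (solve-∀)
open import Data.Product using (∃; _×_; _,_)
open import Data.Sum using ([_,_]′)
open import Data.Vec.Functional using (Vector; removeAt)
open import Function using (_∘_; id)
open import Relation.Binary.PropositionalEquality
open import Relation.Nullary using (yes; no; does)
open import Relation.Nullary.Decidable using (dec-true; dec-false)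

sumᴸ-allFin : ∀ n (f : Fin n → ℕ) → sumᴸ (map f (allFinᴸ n)) ≡ sum f
sumᴸ-allFin n f = trans (cong sumᴸ (map-tabulate id f)) (sumᴸ-tabulate n f)
  where
  sumᴸ-tabulate : ∀ n (f : Fin n → ℕ) → sumᴸ (tabulate f) ≡ sum f
  sumᴸ-tabulate zero    f = refl
  sumᴸ-tabulate (suc n) f = cong (f zero +_) (sumᴸ-tabulate n (f ∘ suc))

sum-const : ∀ n c → ∑[ i < n ] c ≡ n * c
sum-const zero    c = refl
sum-const (suc n) c = cong (c +_) (sum-const n c)

sum-mono-≤ : ∀ {n} {f g : Vector ℕ n} → (∀ i → f i ≤ g i) → sum f ≤ sum g
sum-mono-≤ {zero}  f≤g = z≤n
sum-mono-≤ {suc n} f≤g = +-mono-≤ (f≤g zero) (sum-mono-≤ (f≤g ∘ suc))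

sum-supported : ∀ {n} (i : Fin n) (f : Vector ℕ n) →
                (∀ j → j ≢ i → f j ≡ 0) → sum f ≡ f i
sum-supported {suc n} i f vanishes = begin
  sum f                      ≡⟨ sum-remove f ⟩
  f i + sum (removeAt f i)   ≡⟨ cong (f i +_) (sum-cong-≗ (λ j → vanishes _ (punchInᵢ≢i i j))) ⟩
  f i + ∑[ j < n ] 0         ≡⟨ cong (f i +_) (sum-replicate-zero n) ⟩
  f i + 0                    ≡⟨ +-identityʳ (f i) ⟩
  f i                        ∎
  where open ≡-Reasoning

pigeonhole : ∀ {n} a (f : Vector ℕ (suc n)) → suc n * a ≤ sum f → ∃ λ i → a ≤ f i
pigeonhole {zero}  a f na≤∑f = zero , subst₂ _≤_ (+-identityʳ a) (+-identityʳ (f zero)) na≤∑f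
pigeonhole {suc n} a f na≤∑f with a ≤? f zero
... | yes a≤f₀ = zero , a≤f₀
... | no  a≰f₀ =
  let i , a≤fᵢ = pigeonhole a (f ∘ suc) (+-cancelˡ-≤ a _ _ (≤-trans na≤∑f (+-monoˡ-≤ _ f₀≤a)))
  in  suc i , a≤fᵢ
  where
  f₀≤a : f zero ≤ a
  f₀≤a = <⇒≤ (≰⇒> a≰f₀)

2mn≤m²+n² : ∀ m n → 2 * (m * n) ≤ m * m + n * n
2mn≤m²+n² m n = [ ordered , ordered-swapped ]′ (≤-total m n)
  where
  ordered : ∀ {m n} → m ≤ n → 2 * (m * n) ≤ m * m + n * n
  ordered {m} m≤n with m≤n⇒∃[o]m+o≡n m≤n
  ... | k , refl = subst (2 * (m * (m + k)) ≤_) (identity m k) (m≤m+n _ (k * k))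
    where
    identity : ∀ m k → 2 * (m * (m + k)) + k * k ≡ m * m + (m + k) * (m + k)
    identity = solve-∀
  ordered-swapped : n ≤ m → 2 * (m * n) ≤ m * m + n * n
  ordered-swapped n≤m = subst₂ _≤_ (cong (2 *_) (*-comm n m)) (+-comm (n * n) (m * m)) (ordered n≤m)

∑-distrib-+₃ : ∀ {n} (f g h : Vector ℕ n) →
               ∑[ i < n ] (f i + g i + h i) ≡ sum f + sum g + sum h
∑-distrib-+₃ f g h = trans (∑-distrib-+ _ h) (cong (_+ sum h) (∑-distrib-+ f g))

square-of-sum : ∀ {n} (f : Vector ℕ n) → sum f * sum f ≡ ∑[ i < n ] ∑[ j < n ] (f i * f j)
square-of-sum f = trans (*-distribʳ-sum (sum f) f) (sum-cong-≗ (λ i → *-distribˡ-sum (f i) f))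

cauchy-schwarz : ∀ {n} (f : Vector ℕ n) → sum f * sum f ≤ n * ∑[ i < n ] (f i * f i)
cauchy-schwarz {n} f = *-cancelˡ-≤ 2 (begin
  2 * (sum f * sum f)
    ≡⟨ cong (2 *_) (square-of-sum f) ⟩
  2 * ∑[ i < n ] ∑[ j < n ] (f i * f j)
    ≡⟨ *-distribˡ-sum 2 (λ i → ∑[ j < n ] (f i * f j)) ⟩
  ∑[ i < n ] (2 * ∑[ j < n ] (f i * f j))
    ≡⟨ sum-cong-≗ (λ i → *-distribˡ-sum 2 (λ j → f i * f j)) ⟩
  ∑[ i < n ] ∑[ j < n ] (2 * (f i * f j))
    ≤⟨ sum-mono-≤ (λ i → sum-mono-≤ (λ j → 2mn≤m²+n² (f i) (f j))) ⟩
  ∑[ i < n ] ∑[ j < n ] (f i * f i + f j * f j)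
    ≡⟨ sum-cong-≗ (λ i → ∑-distrib-+ (λ _ → f i * f i) (λ j → f j * f j)) ⟩
  ∑[ i < n ] (∑[ j < n ] (f i * f i) + Q)
    ≡⟨ ∑-distrib-+ (λ i → ∑[ j < n ] (f i * f i)) (λ _ → Q) ⟩
  ∑[ i < n ] ∑[ j < n ] (f i * f i) + ∑[ i < n ] Q
    ≡⟨ cong₂ _+_ (sum-cong-≗ (λ i → sum-const n (f i * f i))) (sum-const n Q) ⟩
  ∑[ i < n ] (n * (f i * f i)) + n * Q
    ≡⟨ cong (_+ n * Q) (*-distribˡ-sum n (λ i → f i * f i)) ⟨
  n * Q + n * Q
    ≡⟨ cong (n * Q +_) (+-identityʳ (n * Q)) ⟨
  2 * (n * Q)
    ∎)
  where
  open ≤-Reasoning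
  Q = ∑[ i < n ] (f i * f i)

-- Read t, d, q as the number of transitive triples, ∑ d⁺ and ∑ (d⁺)²: the
-- conclusion is t ≥ n(n − 1)(n − 3)/8 without denominators or subtraction.
transitive-count-bound : ∀ n t d q → 2 * t + d ≡ q → 2 * d + n ≡ n * n → d * d ≤ n * q →
                         n * (n * n) + 3 * n ≤ 8 * t + 4 * (n * n)
transitive-count-bound zero      t d q _    _         _  = z≤n
transitive-count-bound n@(suc m) t d q refl handshake cs =
  *-cancelˡ-≤ n (+-cancelʳ-≤ (2 * n * (n * m)) _ _ (begin
    n * (n * (n * n) + 3 * n) + 2 * n * (n * m)  ≡⟨ expand m ⟩
    (n * m) * (n * m) + 4 * (n * (n * n))        ≡⟨ cong (λ p → p * p + 4 * (n * (n * n))) 2d≡nm ⟨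
    (2 * d) * (2 * d) + 4 * (n * (n * n))        ≡⟨ cong (_+ 4 * (n * (n * n))) (regroup d) ⟩
    4 * (d * d) + 4 * (n * (n * n))              ≤⟨ +-monoˡ-≤ _ (*-monoʳ-≤ 4 cs) ⟩
    4 * (n * (2 * t + d)) + 4 * (n * (n * n))    ≡⟨ collect n t d ⟩
    n * (8 * t + 4 * (n * n)) + 2 * n * (2 * d)  ≡⟨ cong (λ p → n * (8 * t + 4 * (n * n)) + 2 * n * p) 2d≡nm ⟩
    n * (8 * t + 4 * (n * n)) + 2 * n * (n * m)  ∎))
  where
  open ≤-Reasoning
  square-suc : ∀ m → suc m * suc m ≡ suc m * m + suc m
  square-suc = solve-∀
  2d≡nm : 2 * d ≡ n * m
  2d≡nm = +-cancelʳ-≡ n _ _ (trans handshake (square-suc m))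
  expand : ∀ m → suc m * (suc m * (suc m * suc m) + 3 * suc m) + 2 * suc m * (suc m * m)
                 ≡ (suc m * m) * (suc m * m) + 4 * (suc m * (suc m * suc m))
  expand = solve-∀
  regroup : ∀ d → (2 * d) * (2 * d) ≡ 4 * (d * d)
  regroup = solve-∀
  collect : ∀ n t d → 4 * (n * (2 * t + d)) + 4 * (n * (n * n))
                      ≡ n * (8 * t + 4 * (n * n)) + 2 * n * (2 * d)
  collect = solve-∀

-- n(n − 1)(n − 3)/8 ≥ n³/25 amounts to n(17n² − 100n + 75) ≥ 0; for n = 5 + k
-- the left side is n(17k² + 70k).
n³≤25t : ∀ {n} t → 5 ≤ n → n * (n * n) + 3 * n ≤ 8 * t + 4 * (n * n) → n * (n * n) ≤ 25 * t
n³≤25t {n} t 5≤n bound with m≤n⇒∃[o]m+o≡n 5≤n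
... | k , refl = *-cancelˡ-≤ 8 (+-cancelʳ-≤ (100 * (n * n)) _ _ (begin
  8 * (n * (n * n)) + 100 * (n * n)                               ≤⟨ m≤m+n _ _ ⟩
  8 * (n * (n * n)) + 100 * (n * n) + n * (17 * (k * k) + 70 * k) ≡⟨ slack k ⟩
  25 * (n * (n * n) + 3 * n)                                      ≤⟨ *-monoʳ-≤ 25 bound ⟩
  25 * (8 * t + 4 * (n * n))                                      ≡⟨ distribute t n ⟩
  8 * (25 * t) + 100 * (n * n)                                    ∎))
  where
  open ≤-Reasoning
  slack : ∀ k → 8 * ((5 + k) * ((5 + k) * (5 + k))) + 100 * ((5 + k) * (5 + k)) + (5 + k) * (17 * (k * k) + 70 * k)
                ≡ 25 * ((5 + k) * ((5 + k) * (5 + k)) + 3 * (5 + k))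
  slack = solve-∀
  distribute : ∀ t n → 25 * (8 * t + 4 * (n * n)) ≡ 8 * (25 * t) + 100 * (n * n)
  distribute = solve-∀

n²≤cab⇒n≤ca : ∀ {n} c a b → n * n ≤ c * (a * b) → b ≤ n → n ≤ c * a
n²≤cab⇒n≤ca {zero}      c a b _   _   = z≤n
n²≤cab⇒n≤ca {n@(suc _)} c a b n²≤ b≤n = *-cancelʳ-≤ n (c * a) n (begin
  n * n       ≤⟨ n²≤ ⟩
  c * (a * b) ≤⟨ *-monoʳ-≤ c (*-monoʳ-≤ a b≤n) ⟩
  c * (a * n) ≡⟨ *-assoc c a n ⟨
  c * a * n   ∎)
  where open ≤-Reasoning

𝟙 : Bool → ℕ
𝟙 b = if b then 1 else 0

𝟙-∧ : ∀ a b → 𝟙 (a ∧ b) ≡ 𝟙 a * 𝟙 b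
𝟙-∧ true  b = sym (+-identityʳ (𝟙 b))
𝟙-∧ false b = refl

𝟙-idem : ∀ a → 𝟙 a * 𝟙 a ≡ 𝟙 a
𝟙-idem true  = refl
𝟙-idem false = refl

𝟙≤1 : ∀ a → 𝟙 a ≤ 1
𝟙≤1 true  = s≤s z≤n
𝟙≤1 false = z≤n

count-≡-∑ : ∀ {n} (p : Fin n → Bool) → count p ≡ ∑[ x < n ] 𝟙 (p x)
count-≡-∑ {n} p = sumᴸ-allFin n (𝟙 ∘ p)

count≤n : ∀ {n} (p : Fin n → Bool) → count p ≤ n
count≤n {n} p = begin
  count p               ≡⟨ count-≡-∑ p ⟩
  ∑[ x < n ] 𝟙 (p x)    ≤⟨ sum-mono-≤ (𝟙≤1 ∘ p) ⟩
  ∑[ x < n ] 1          ≡⟨ sum-const n 1 ⟩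
  n * 1                 ≡⟨ *-identityʳ n ⟩
  n                     ∎
  where open ≤-Reasoning

module _ {n : ℕ} (T : Tournament n) where

  ⟦_⇒_⟧ : Fin n → Fin n → ℕ
  ⟦ u ⇒ v ⟧ = 𝟙 (arc T u v)

  δ : Fin n → Fin n → ℕ
  δ u v = 𝟙 (does (u ≟ v))

  arc-trichotomy : ∀ u v → ⟦ u ⇒ v ⟧ + ⟦ v ⇒ u ⟧ + δ u v ≡ 1
  arc-trichotomy u v with u ≟ v
  ... | yes refl rewrite loopless T u = refl
  ... | no u≢v rewrite oneArc T u v u≢v with arc T v u
  ...   | true  = refl
  ...   | false = refl

  ∑-δ : ∀ (g : Vector ℕ n) v → ∑[ y < n ] (g y * δ v y) ≡ g v
  ∑-δ g v = trans (sum-supported v _ off-diagonal) diagonal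
    where
    off-diagonal : ∀ y → y ≢ v → g y * δ v y ≡ 0
    off-diagonal y y≢v rewrite dec-false (v ≟ y) (y≢v ∘ sym) = *-zeroʳ (g y)
    diagonal : g v * δ v v ≡ g v
    diagonal rewrite dec-true (v ≟ v) refl = *-identityʳ (g v)

  outdeg-≡-∑ : ∀ x → outdeg T x ≡ ∑[ y < n ] ⟦ x ⇒ y ⟧
  outdeg-≡-∑ x = count-≡-∑ (arc T x)

  indeg-≡-∑ : ∀ y → indeg T y ≡ ∑[ x < n ] ⟦ x ⇒ y ⟧
  indeg-≡-∑ y = count-≡-∑ (λ x → arc T x y)

  outdeg≤n : ∀ v → outdeg T v ≤ n
  outdeg≤n v = count≤n (arc T v)

  indeg≤n : ∀ v → indeg T v ≤ n
  indeg≤n v = count≤n (λ x → arc T x v)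

  transitive : Fin n → Fin n → Fin n → ℕ
  transitive x v y = ⟦ x ⇒ v ⟧ * (⟦ v ⇒ y ⟧ * ⟦ x ⇒ y ⟧)

  transitiveFrom : Fin n → ℕ
  transitiveFrom x = ∑[ v < n ] ∑[ y < n ] transitive x v y

  crossArcs-≡-∑ : ∀ v → crossArcs T v ≡ ∑[ x < n ] ∑[ y < n ] transitive x v y
  crossArcs-≡-∑ v = trans (sumᴸ-allFin n _) (sum-cong-≗ (λ x →
    trans (count-≡-∑ (λ y → arc T x v ∧ arc T v y ∧ arc T x y))
          (sum-cong-≗ (λ y → 𝟙-∧³ (arc T x v) (arc T v y) (arc T x y)))))
    where
    𝟙-∧³ : ∀ a b c → 𝟙 (a ∧ b ∧ c) ≡ 𝟙 a * (𝟙 b * 𝟙 c)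
    𝟙-∧³ a b c = trans (𝟙-∧ a (b ∧ c)) (cong (𝟙 a *_) (𝟙-∧ b c))

  ∑-crossArcs : ∑[ v < n ] crossArcs T v ≡ ∑[ x < n ] transitiveFrom x
  ∑-crossArcs = trans (sum-cong-≗ crossArcs-≡-∑) (∑-comm (λ v x → ∑[ y < n ] transitive x v y))

  crossArcs≤indeg*outdeg : ∀ v → crossArcs T v ≤ indeg T v * outdeg T v
  crossArcs≤indeg*outdeg v = begin
    crossArcs T v
      ≡⟨ crossArcs-≡-∑ v ⟩
    ∑[ x < n ] ∑[ y < n ] transitive x v y
      ≤⟨ sum-mono-≤ (λ x → sum-mono-≤ (λ y → drop-last x y)) ⟩
    ∑[ x < n ] ∑[ y < n ] (⟦ x ⇒ v ⟧ * ⟦ v ⇒ y ⟧)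
      ≡⟨ sum-cong-≗ (λ x → *-distribˡ-sum ⟦ x ⇒ v ⟧ (λ y → ⟦ v ⇒ y ⟧)) ⟨
    ∑[ x < n ] (⟦ x ⇒ v ⟧ * ∑[ y < n ] ⟦ v ⇒ y ⟧)
      ≡⟨ *-distribʳ-sum (∑[ y < n ] ⟦ v ⇒ y ⟧) (λ x → ⟦ x ⇒ v ⟧) ⟨
    ∑[ x < n ] ⟦ x ⇒ v ⟧ * ∑[ y < n ] ⟦ v ⇒ y ⟧
      ≡⟨ cong₂ _*_ (indeg-≡-∑ v) (outdeg-≡-∑ v) ⟨
    indeg T v * outdeg T v
      ∎
    where
    open ≤-Reasoning
    drop-last : ∀ x y → transitive x v y ≤ ⟦ x ⇒ v ⟧ * ⟦ v ⇒ y ⟧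
    drop-last x y = *-monoʳ-≤ ⟦ x ⇒ v ⟧
      (≤-trans (*-monoʳ-≤ ⟦ v ⇒ y ⟧ (𝟙≤1 (arc T x y))) (≤-reflexive (*-identityʳ ⟦ v ⇒ y ⟧)))

  pair-split : ∀ x v y → ⟦ x ⇒ v ⟧ * ⟦ x ⇒ y ⟧
               ≡ transitive x v y + transitive x y v + ⟦ x ⇒ v ⟧ * ⟦ x ⇒ y ⟧ * δ v y
  pair-split x v y = begin
    p * q                                   ≡⟨ *-identityʳ (p * q) ⟨
    p * q * 1                               ≡⟨ cong (p * q *_) (arc-trichotomy v y) ⟨
    p * q * (⟦ v ⇒ y ⟧ + ⟦ y ⇒ v ⟧ + δ v y) ≡⟨ distribute p q ⟦ v ⇒ y ⟧ ⟦ y ⇒ v ⟧ (δ v y) ⟩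
    transitive x v y + transitive x y v + p * q * δ v y ∎
    where
    open ≡-Reasoning
    p = ⟦ x ⇒ v ⟧
    q = ⟦ x ⇒ y ⟧
    distribute : ∀ p q r s t → p * q * (r + s + t) ≡ p * (r * q) + q * (s * p) + p * q * t
    distribute = solve-∀

  outdeg-square : ∀ x → outdeg T x * outdeg T x ≡ 2 * transitiveFrom x + outdeg T x
  outdeg-square x = begin
    outdeg T x * outdeg T x
      ≡⟨ cong₂ _*_ (outdeg-≡-∑ x) (outdeg-≡-∑ x) ⟩
    ∑[ y < n ] ⟦ x ⇒ y ⟧ * ∑[ y < n ] ⟦ x ⇒ y ⟧
      ≡⟨ square-of-sum (λ y → ⟦ x ⇒ y ⟧) ⟩
    ∑[ v < n ] ∑[ y < n ] (⟦ x ⇒ v ⟧ * ⟦ x ⇒ y ⟧)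
      ≡⟨ sum-cong-≗ (λ v → trans (sum-cong-≗ (pair-split x v))
                                  (∑-distrib-+₃ (transitive x v) (λ y → transitive x y v) (diagonal v))) ⟩
    ∑[ v < n ] (∑[ y < n ] transitive x v y + ∑[ y < n ] transitive x y v + sum (diagonal v))
      ≡⟨ ∑-distrib-+₃ (λ v → ∑[ y < n ] transitive x v y) (λ v → ∑[ y < n ] transitive x y v)
                     (sum ∘ diagonal) ⟩
    transitiveFrom x + ∑[ v < n ] ∑[ y < n ] transitive x y v + ∑[ v < n ] sum (diagonal v)
      ≡⟨ cong₂ (λ a b → transitiveFrom x + a + b)
               (∑-comm (λ v y → transitive x y v)) (sum-cong-≗ ∑-diagonal) ⟩
    transitiveFrom x + transitiveFrom x + ∑[ v < n ] ⟦ x ⇒ v ⟧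
      ≡⟨ cong₂ _+_ (cong (transitiveFrom x +_) (+-identityʳ _)) (outdeg-≡-∑ x) ⟨
    2 * transitiveFrom x + outdeg T x
      ∎
    where
    open ≡-Reasoning
    diagonal : Fin n → Vector ℕ n
    diagonal v y = ⟦ x ⇒ v ⟧ * ⟦ x ⇒ y ⟧ * δ v y
    ∑-diagonal : ∀ v → sum (diagonal v) ≡ ⟦ x ⇒ v ⟧
    ∑-diagonal v = trans (∑-δ (λ y → ⟦ x ⇒ v ⟧ * ⟦ x ⇒ y ⟧) v) (𝟙-idem (arc T x v))

  ∑-outdeg : 2 * ∑[ x < n ] outdeg T x + n ≡ n * n
  ∑-outdeg = begin
    2 * D + n
      ≡⟨ cong₂ _+_ (cong (D +_) (+-identityʳ D)) (sym ∑-δ-diagonal) ⟩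
    D + D + ∑[ x < n ] ∑[ y < n ] δ x y
      ≡⟨ cong₂ (λ a b → a + b + ∑[ x < n ] ∑[ y < n ] δ x y) out-arcs in-arcs ⟩
    ∑[ x < n ] ∑[ y < n ] ⟦ x ⇒ y ⟧ + ∑[ x < n ] ∑[ y < n ] ⟦ y ⇒ x ⟧ + ∑[ x < n ] ∑[ y < n ] δ x y
      ≡⟨ ∑-distrib-+₃ (λ x → ∑[ y < n ] ⟦ x ⇒ y ⟧) (λ x → ∑[ y < n ] ⟦ y ⇒ x ⟧) (λ x → ∑[ y < n ] δ x y) ⟨
    ∑[ x < n ] (∑[ y < n ] ⟦ x ⇒ y ⟧ + ∑[ y < n ] ⟦ y ⇒ x ⟧ + ∑[ y < n ] δ x y)
      ≡⟨ sum-cong-≗ (λ x → ∑-distrib-+₃ (λ y → ⟦ x ⇒ y ⟧) (λ y → ⟦ y ⇒ x ⟧) (δ x)) ⟨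
    ∑[ x < n ] ∑[ y < n ] (⟦ x ⇒ y ⟧ + ⟦ y ⇒ x ⟧ + δ x y)
      ≡⟨ sum-cong-≗ (λ x → sum-cong-≗ (arc-trichotomy x)) ⟩
    ∑[ x < n ] ∑[ y < n ] 1
      ≡⟨ sum-const n (∑[ y < n ] 1) ⟩
    n * ∑[ y < n ] 1
      ≡⟨ cong (n *_) ∑1≡n ⟩
    n * n
      ∎
    where
    open ≡-Reasoning
    D = ∑[ x < n ] outdeg T x
    ∑1≡n : ∑[ y < n ] 1 ≡ n
    ∑1≡n = trans (sum-const n 1) (*-identityʳ n)
    ∑-δ-diagonal : ∑[ x < n ] ∑[ y < n ] δ x y ≡ n
    ∑-δ-diagonal = trans (sum-cong-≗ ∑-δ-row) ∑1≡n
      where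
      ∑-δ-row : ∀ x → ∑[ y < n ] δ x y ≡ 1
      ∑-δ-row x = trans (sum-cong-≗ (λ y → sym (*-identityˡ (δ x y)))) (∑-δ (λ _ → 1) x)
    out-arcs : D ≡ ∑[ x < n ] ∑[ y < n ] ⟦ x ⇒ y ⟧
    out-arcs = sum-cong-≗ outdeg-≡-∑
    in-arcs : D ≡ ∑[ x < n ] ∑[ y < n ] ⟦ y ⇒ x ⟧
    in-arcs = trans out-arcs (∑-comm (λ x y → ⟦ x ⇒ y ⟧))

  ∑-outdeg² : ∑[ x < n ] (outdeg T x * outdeg T x) ≡ 2 * ∑[ v < n ] crossArcs T v + ∑[ x < n ] outdeg T x
  ∑-outdeg² = begin
    ∑[ x < n ] (outdeg T x * outdeg T x)
      ≡⟨ sum-cong-≗ outdeg-square ⟩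
    ∑[ x < n ] (2 * transitiveFrom x + outdeg T x)
      ≡⟨ ∑-distrib-+ (λ x → 2 * transitiveFrom x) (outdeg T) ⟩
    ∑[ x < n ] (2 * transitiveFrom x) + ∑[ x < n ] outdeg T x
      ≡⟨ cong (_+ sum (outdeg T)) (*-distribˡ-sum 2 transitiveFrom) ⟨
    2 * ∑[ x < n ] transitiveFrom x + ∑[ x < n ] outdeg T x
      ≡⟨ cong (λ s → 2 * s + sum (outdeg T)) ∑-crossArcs ⟨
    2 * ∑[ v < n ] crossArcs T v + ∑[ x < n ] outdeg T x
      ∎
    where open ≡-Reasoning

  ∑-crossArcs-lower-bound : n * (n * n) + 3 * n ≤ 8 * ∑[ v < n ] crossArcs T v + 4 * (n * n)
  ∑-crossArcs-lower-bound =
    transitive-count-bound n (sum (crossArcs T)) (sum (outdeg T)) _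
      (sym ∑-outdeg²) ∑-outdeg (cauchy-schwarz (outdeg T))

lemma3p11 : (n : ℕ) → 5 ≤ n → (T : Tournament n) →
    ∃ λ (v : Fin n) →
    (n * n ≤ 25 * crossArcs T v) ×
    (n ≤ 25 * outdeg T v) × (n ≤ 25 * indeg T v)
lemma3p11 zero      ()  T
lemma3p11 n@(suc _) 5≤n T =
  let v , n²≤25c = pigeonhole (n * n) (λ v → 25 * crossArcs T v) crossArcs-large
      n²≤25io    = ≤-trans n²≤25c (*-monoʳ-≤ 25 (crossArcs≤indeg*outdeg T v))
      n²≤25oi    = subst (λ p → n * n ≤ 25 * p) (*-comm (indeg T v) (outdeg T v)) n²≤25io
  in v , n²≤25c
       , n²≤cab⇒n≤ca 25 (outdeg T v) (indeg T v) n²≤25oi (indeg≤n T v)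
       , n²≤cab⇒n≤ca 25 (indeg T v) (outdeg T v) n²≤25io (outdeg≤n T v)
  where
  crossArcs-large : n * (n * n) ≤ ∑[ v < n ] (25 * crossArcs T v)
  crossArcs-large = ≤-trans (n³≤25t (∑[ v < n ] crossArcs T v) 5≤n (∑-crossArcs-lower-bound T))
                            (≤-reflexive (*-distribˡ-sum 25 (crossArcs T)))
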